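{- Let $G$ be a finite simple graph, $X$ a solution, $v\in AWS(X)$ such that $Y=X\cup\{v\}$ is a solution, and $u\in N^2_Y(v)\cap WS(X)$. Then $u\in\mathrm{Del}_{WS}(X,v)$ if and only if there exist $w_1,w_2\in N_X(u)$ with $N_X(w_1)\subsetneq N_X(w_2)$, $v\in N_Y(w_1)$ and $v\notin N_Y(w_2)$.
   Context: For $S\subseteq V$, $N_S(u)=N(u)\cap S$; $N^2_Y(v)$ is the set of vertices at distance exactly $2$ from $v$ in $G[Y]$. In $G[S]$, $a,b$ are comparable if $N_S(a)\subseteq N_S(b)$ or $N_S(b)\subseteq N_S(a)$; $u\in S$ is weak-simplicial in $G[S]$ if $N_S(u)$ is independent and any two vertices of $N_S(u)$ are comparable in $G[S]$. A solution is $X\subseteq V$ with $G[X]$ chordal bipartite (bipartite, no induced cycle of length $\ge6$). $WS(X)$ is the set of weak-simplicial vertices of $G[X]$. $AWS(X)=\{u\in V\setminus X: u\in WS(X\cup\{u\})\}$. $N^{1:2}(v)$ is the set of vertices at distance $1$ or $2$ from $v$ in $G$. $\mathrm{Del}_{WS}(X,v)=\{u\in N^{1:2}(v)\cap WS(X): u\notin WS(X\cup\{v\})\}$. -}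

module Defs where

open import Level using (0ℓ)
open import Data.Nat using (ℕ; _≤_; _+_; _%_; NonZero)
open import Data.Fin using (Fin; toℕ)
open import Data.Fin.Subset using (Subset; _∪_; ⁅_⁆) renaming (_∈_ to _∈ₛ_; _∉_ to _∉ₛ_)
open import Data.Bool using (Bool)
open import Data.Product using (Σ; _×_; ∃-syntax; _,_)
open import Data.Sum using (_⊎_)
open import Relation.Nullary using (¬_)
open import Relation.Unary using (Pred; _⊆_; _⊂_)
open import Relation.Binary using (Decidable)
open import Relation.Binary.PropositionalEquality using (_≡_; _≢_)
open import Function.Definitions using (Injective)

record Graph (n : ℕ) : Set₁ where
  field
    Adj    : Fin n → Fin n → Set
    adj?   : Decidable Adj
    sym    : ∀ {x y} → Adj x y → Adj y x
    irrefl : ∀ {x} → ¬ Adj x x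
open Graph public

module _ {n : ℕ} (G : Graph n) where

  N : Subset n → Fin n → Pred (Fin n) 0ℓ
  N S u x = x ∈ₛ S × Adj G u x

  N2 : Subset n → Fin n → Pred (Fin n) 0ℓ
  N2 Y v u = v ∈ₛ Y × u ∈ₛ Y × u ≢ v × ¬ Adj G v u
             × (∃[ w ] (w ∈ₛ Y × Adj G v w × Adj G w u))

  N12 : Fin n → Pred (Fin n) 0ℓ
  N12 v u = u ≢ v × (Adj G v u ⊎ (∃[ w ] (Adj G v w × Adj G w u)))

  Comparable : Subset n → Fin n → Fin n → Set
  Comparable S a b = N S a ⊆ N S b ⊎ N S b ⊆ N S a

  WeakSimplicial : Subset n → Fin n → Set
  WeakSimplicial S u =
    u ∈ₛ S
    × (∀ a b → a ∈ N S u → b ∈ N S u → ¬ Adj G a b)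
    × (∀ a b → a ∈ N S u → b ∈ N S u → Comparable S a b)
    where open Relation.Unary using (_∈_)

  WS : Subset n → Pred (Fin n) 0ℓ
  WS X u = WeakSimplicial X u

  AWS : Subset n → Pred (Fin n) 0ℓ
  AWS X u = u ∉ₛ X × WS (X ∪ ⁅ u ⁆) u

  DelWS : Subset n → Fin n → Pred (Fin n) 0ℓ
  DelWS X v u = N12 v u × WS X u × ¬ WS (X ∪ ⁅ v ⁆) u

  Bipartite : Subset n → Set
  Bipartite S = Σ (Fin n → Bool) λ c → (∀ x y → x ∈ₛ S → y ∈ₛ S → Adj G x y → c x ≢ c y)

  CycAdj : (k : ℕ) .{{_ : NonZero k}} → Fin k → Fin k → Set
  CycAdj k i j = toℕ j ≡ (toℕ i + 1) % k ⊎ toℕ i ≡ (toℕ j + 1) % k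

  -- an induced cycle of length k in G[S], given as an injective
  -- enumeration of its vertices in cyclic order
  InducedCycle : Subset n → (k : ℕ) .{{_ : NonZero k}} → Set
  InducedCycle S k =
    Σ (Fin k → Fin n) λ f →
      Injective _≡_ _≡_ f
      × (∀ i → f i ∈ₛ S)
      × (∀ i j → (Adj G (f i) (f j) → CycAdj k i j) × (CycAdj k i j → Adj G (f i) (f j)))

  ChordalBipartite : Subset n → Set
  ChordalBipartite S =
    Bipartite S × (∀ k → 6 ≤ k → (nz : NonZero k) → ¬ InducedCycle S k {{nz}})

  Solution : Subset n → Set
  Solution X = ChordalBipartite X

module Submission where

open import Defs
open import Data.Nat using (ℕ)
open import Data.Fin using (Fin)
open import Data.Fin.Subset using (Subset; _∪_; ⁅_⁆)
open import Data.Product using (_×_; ∃-syntax)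
open import Function.Bundles using (_⇔_)
open import Relation.Nullary using (¬_)
open import Relation.Unary using (_∈_; _⊂_)

open import Data.Product using (_,_; proj₁; proj₂)
open import Data.Sum using (_⊎_; inj₁; inj₂; swap)
open import Data.Fin.Properties using (any?; all?)
open import Data.Fin.Subset.Properties using (p⊆p∪q; q⊆p∪q; x∈p∪q⁻; x∈⁅x⁆; x∈⁅y⁆⇒x≡y; _∈?_)
open import Function.Bundles using (mk⇔)
open import Relation.Nullary using (Dec; yes; no; contradiction)
open import Relation.Nullary.Decidable using (_×-dec_; _→-dec_; ¬?)
open import Relation.Binary.PropositionalEquality using (_≡_; refl)
open import Relation.Unary using (_⊆_)
open import Data.Fin.Subset using () renaming (_∈_ to _∈ₛ_)

-- As u is not adjacent to v, N_Y(u) = N_X(u), so independence of the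
-- neighbourhood survives the addition of v and only comparability can break. For
-- w ∈ N_X(u), N_Y(w) is N_X(w) plus v exactly when w ~ v. Hence an X-inclusion
-- N_X(w₁) ⊆ N_X(w₂) persists in Y unless w₁ ~ v and w₂ ≁ v, and then the pair
-- stays comparable in Y only if N_X(w₁) = N_X(w₂). Since everything is finite and
-- decidable, the failure of weak-simpliciality in Y produces such a pair.

N2⇒N12 : ∀ {n} (G : Graph n) {Y v u} → u ∈ N2 G Y v → u ∈ N12 G v
N2⇒N12 G (_ , _ , u≢v , _ , w , _ , vw , wu) = u≢v , inj₂ (w , vw , wu)

module _ {n : ℕ} (G : Graph n) (X : Subset n) where

  N? : ∀ a x → Dec (x ∈ N G X a)
  N? a x = (x ∈? X) ×-dec adj? G a x

  N-⊆? : ∀ a b → Dec (N G X a ⊆ N G X b)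
  N-⊆? a b with all? (λ x → N? a x →-dec N? b x)
  ... | yes a⊆b = yes (λ {x} → a⊆b x)
  ... | no ¬a⊆b = no (λ a⊆b → ¬a⊆b (λ _ → a⊆b))

module _ {n : ℕ} (G : Graph n) (X : Subset n) (v : Fin n) where

  ∈-∪⁅⁆⁻ : ∀ {x} → x ∈ₛ X ∪ ⁅ v ⁆ → x ∈ₛ X ⊎ x ≡ v
  ∈-∪⁅⁆⁻ x∈Y with x∈p∪q⁻ X ⁅ v ⁆ x∈Y
  ... | inj₁ x∈X = inj₁ x∈X
  ... | inj₂ x∈⁅v⁆ = inj₂ (x∈⁅y⁆⇒x≡y v x∈⁅v⁆)

  ∈-∪⁅⁆ˡ : ∀ {x} → x ∈ₛ X → x ∈ₛ X ∪ ⁅ v ⁆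
  ∈-∪⁅⁆ˡ = p⊆p∪q ⁅ v ⁆

  v∈-∪⁅⁆ : v ∈ₛ X ∪ ⁅ v ⁆
  v∈-∪⁅⁆ = q⊆p∪q X ⁅ v ⁆ (x∈⁅x⁆ v)

  N-⊆-∪⁅⁆ : ∀ {a} → N G X a ⊆ N G (X ∪ ⁅ v ⁆) a
  N-⊆-∪⁅⁆ (x∈X , ax) = ∈-∪⁅⁆ˡ x∈X , ax

  N-∪⁅⁆-nonadj : ∀ {a} → ¬ Adj G v a → N G (X ∪ ⁅ v ⁆) a ⊆ N G X a
  N-∪⁅⁆-nonadj ¬va (x∈Y , ax) with ∈-∪⁅⁆⁻ x∈Y
  ... | inj₁ x∈X = x∈X , ax
  ... | inj₂ refl = contradiction (sym G ax) ¬va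

  N-∪⁅⁆-restrict : ∀ {a b} → N G (X ∪ ⁅ v ⁆) a ⊆ N G (X ∪ ⁅ v ⁆) b → N G X a ⊆ N G X b
  N-∪⁅⁆-restrict a⊆b {x} (x∈X , ax) = x∈X , proj₂ (a⊆b (∈-∪⁅⁆ˡ x∈X , ax))

  N-∪⁅⁆-mono : ∀ {a b} → N G X a ⊆ N G X b → (Adj G a v → Adj G b v) →
               N G (X ∪ ⁅ v ⁆) a ⊆ N G (X ∪ ⁅ v ⁆) b
  N-∪⁅⁆-mono a⊆b av⇒bv (x∈Y , ax) with ∈-∪⁅⁆⁻ x∈Y
  ... | inj₁ x∈X = N-⊆-∪⁅⁆ (a⊆b (x∈X , ax))
  ... | inj₂ refl = v∈-∪⁅⁆ , av⇒bv ax

  SeparatedBy : Fin n → Fin n → Set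
  SeparatedBy a b = N G X a ⊂ N G X b × v ∈ N G (X ∪ ⁅ v ⁆) a × ¬ (v ∈ N G (X ∪ ⁅ v ⁆) b)

  separatedBy? : ∀ a b → Dec (SeparatedBy a b)
  separatedBy? a b =
    (N-⊆? G X a b ×-dec ¬? (N-⊆? G X b a))
      ×-dec (v ∈? (X ∪ ⁅ v ⁆) ×-dec adj? G a v)
      ×-dec ¬? (v ∈? (X ∪ ⁅ v ⁆) ×-dec adj? G b v)

  separatedBy⇒¬comparable : ∀ {a b} → SeparatedBy a b → ¬ Comparable G (X ∪ ⁅ v ⁆) a b
  separatedBy⇒¬comparable (_ , v∈Na , v∉Nb) (inj₁ a⊆b) = v∉Nb (a⊆b v∈Na)
  separatedBy⇒¬comparable ((_ , b⊈a) , _ , _) (inj₂ b⊆a) = b⊈a (N-∪⁅⁆-restrict b⊆a)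

  ⊆⇒comparable-∪⁅⁆⊎separatedBy : ∀ a b → N G X a ⊆ N G X b →
                                   Comparable G (X ∪ ⁅ v ⁆) a b ⊎ SeparatedBy a b
  ⊆⇒comparable-∪⁅⁆⊎separatedBy a b a⊆b with adj? G a v | adj? G b v
  ... | no ¬av | _      = inj₁ (inj₁ (N-∪⁅⁆-mono a⊆b (λ av → contradiction av ¬av)))
  ... | yes _  | yes bv = inj₁ (inj₁ (N-∪⁅⁆-mono a⊆b (λ _ → bv)))
  ... | yes av | no ¬bv with N-⊆? G X b a
  ...   | yes b⊆a = inj₁ (inj₂ (N-∪⁅⁆-mono b⊆a (λ _ → av)))
  ...   | no b⊈a  = inj₂ ((a⊆b , b⊈a) , (v∈-∪⁅⁆ , av) , λ v∈Nb → ¬bv (proj₂ v∈Nb))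

  module _ (u : Fin n) where

    SeparatedPair : Set
    SeparatedPair = ∃[ a ] ∃[ b ] (a ∈ N G X u × b ∈ N G X u × SeparatedBy a b)

    separatedPair? : Dec SeparatedPair
    separatedPair? = any? λ a → any? λ b → N? G X u a ×-dec N? G X u b ×-dec separatedBy? a b

    separatedPair⇒¬WS-∪⁅⁆ : SeparatedPair → ¬ u ∈ WS G (X ∪ ⁅ v ⁆)
    separatedPair⇒¬WS-∪⁅⁆ (a , b , ua , ub , sep) (_ , _ , comparable) =
      separatedBy⇒¬comparable sep (comparable a b (N-⊆-∪⁅⁆ ua) (N-⊆-∪⁅⁆ ub))

    WS-∪⁅⁆ : ¬ Adj G v u → u ∈ WS G X → ¬ SeparatedPair → u ∈ WS G (X ∪ ⁅ v ⁆)
    WS-∪⁅⁆ ¬vu (u∈X , independent , comparable) noPair =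
      ∈-∪⁅⁆ˡ u∈X ,
      (λ a b ua ub → independent a b (shrink ua) (shrink ub)) ,
      (λ a b ua ub → comparable-∪⁅⁆ a b (shrink ua) (shrink ub))
      where
      shrink : N G (X ∪ ⁅ v ⁆) u ⊆ N G X u
      shrink = N-∪⁅⁆-nonadj ¬vu

      ordered : ∀ a b → a ∈ N G X u → b ∈ N G X u → N G X a ⊆ N G X b →
                Comparable G (X ∪ ⁅ v ⁆) a b
      ordered a b ua ub a⊆b with ⊆⇒comparable-∪⁅⁆⊎separatedBy a b a⊆b
      ... | inj₁ cmp = cmp
      ... | inj₂ sep = contradiction (a , b , ua , ub , sep) noPair

      comparable-∪⁅⁆ : ∀ a b → a ∈ N G X u → b ∈ N G X u → Comparable G (X ∪ ⁅ v ⁆) a b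
      comparable-∪⁅⁆ a b ua ub with comparable a b ua ub
      ... | inj₁ a⊆b = ordered a b ua ub a⊆b
      ... | inj₂ b⊆a = swap (ordered b a ub ua b⊆a)

    ¬WS-∪⁅⁆⇒separatedPair : ¬ Adj G v u → u ∈ WS G X → ¬ u ∈ WS G (X ∪ ⁅ v ⁆) → SeparatedPair
    ¬WS-∪⁅⁆⇒separatedPair ¬vu wsX ¬wsY with separatedPair?
    ... | yes pair = pair
    ... | no noPair = contradiction (WS-∪⁅⁆ ¬vu wsX noPair) ¬wsY

lemma10 : {n : ℕ} (G : Graph n) (X : Subset n) (v u : Fin n) →
    Solution G X →
    v ∈ AWS G X →
    Solution G (X ∪ ⁅ v ⁆) →
    u ∈ N2 G (X ∪ ⁅ v ⁆) v →
    u ∈ WS G X →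
    (u ∈ DelWS G X v ⇔
      (∃[ w₁ ] ∃[ w₂ ] (w₁ ∈ N G X u × w₂ ∈ N G X u
        × N G X w₁ ⊂ N G X w₂
        × v ∈ N G (X ∪ ⁅ v ⁆) w₁
        × ¬ (v ∈ N G (X ∪ ⁅ v ⁆) w₂))))
lemma10 G X v u _ _ _ u∈N2 wsX = mk⇔
  (λ (_ , _ , ¬wsY) → ¬WS-∪⁅⁆⇒separatedPair G X v u ¬vu wsX ¬wsY)
  (λ pair → N2⇒N12 G u∈N2 , wsX , separatedPair⇒¬WS-∪⁅⁆ G X v u pair)
  where
  ¬vu : ¬ Adj G v u
  ¬vu = proj₁ (proj₂ (proj₂ (proj₂ u∈N2)))
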